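{- There exists a regular, triangle-distinct graph. More specifically, for each pair $(n,r)\in\{(21,10),(22,10),(23,10),(24,11),(25,12),(26,12),(27,12)\}$ there exists an $r$-regular triangle-distinct simple graph on $n$ vertices.
   Context: All graphs are finite, simple and undirected. For a graph $G=(V,E)$ and a vertex $v\in V$, the triangle-degree $t(v)$ is the number of triangles (sets of three pairwise adjacent vertices) of $G$ that contain $v$. A graph is called triangle-distinct if all its vertices have pairwise distinct triangle-degrees, i.e., $t(u)\neq t(v)$ for all distinct $u,v\in V$. A graph is $r$-regular if every vertex has exactly $r$ neighbours, and regular if it is $r$-regular for some $r$. -}

module Defs where

open import Data.Nat using (ℕ; zero; suc; _+_)
open import Data.Fin using (Fin; _<_)
open import Data.List using (List; allFin; filter; length)
open import Relation.Nullary using (¬_; Dec)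
open import Relation.Unary using (Decidable)
open import Relation.Binary.PropositionalEquality using (_≡_)
open import Data.Product using (_×_)
open import Data.Nat.ListAction using (sum)

record Graph (n : ℕ) : Set₁ where
  field
    Adj      : Fin n → Fin n → Set
    adj?     : (u v : Fin n) → Dec (Adj u v)
    sym      : ∀ {u v} → Adj u v → Adj v u
    irrefl   : ∀ {v} → ¬ Adj v v

open Graph public

count : ∀ {n} {P : Fin n → Set} → Decidable P → ℕ
count {n} P? = length (filter P? (allFin n))

degree : ∀ {n} (G : Graph n) → Fin n → ℕ
degree G v = count (λ u → adj? G v u)

dec× : ∀ {A B : Set} → Dec A → Dec B → Dec (A × B)
dec× = Relation.Nullary._×-dec_

-- triangle-degree t(v): number of triangles {v,u,w} containing v, each counted once
-- via the ordered representation u < w with u, w both adjacent to v and to each other.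
triangleDegree : ∀ {n} (G : Graph n) → Fin n → ℕ
triangleDegree {n} G v =
  sumFin (λ u → count (λ w → dec× (Data.Fin._<?_ u w)
                               (dec× (adj? G v u) (dec× (adj? G v w) (adj? G u w)))))
  where
    sumFin : (Fin n → ℕ) → ℕ
    sumFin f = sum (Data.List.map f (allFin n))

IsRegular : ∀ {n} → Graph n → ℕ → Set
IsRegular {n} G r = (v : Fin n) → degree G v ≡ r

TriangleDistinct : ∀ {n} → Graph n → Set
TriangleDistinct {n} G = (u v : Fin n) → triangleDegree G u ≡ triangleDegree G v → u ≡ v

module Submission where

open import Defs
open import Data.Nat using (ℕ)
import Data.Nat as Nat
open import Data.Fin using (Fin; toℕ; _<_; _<?_)
open import Data.Fin.Properties using (all?; <-irrefl)
open import Data.Vec using (Vec; []; _∷_; lookup)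
open import Data.List using (List; []; _∷_; map; allFin)
open import Data.List.Membership.Propositional using (_∈_)
open import Data.List.Membership.Propositional.Properties using (∈-map⁺; ∈-allFin)
open import Data.List.Membership.DecPropositional Nat._≟_ using (_∈?_)
open import Data.List.Relation.Unary.Any using (here; there)
import Data.List.Relation.Unary.All as All
open import Data.List.Relation.Unary.AllPairs using (_∷_)
open import Data.List.Relation.Unary.Unique.Propositional using (Unique)
open import Data.List.Relation.Unary.Unique.Propositional.Properties using (map⁺; allFin⁺)
open import Data.List.Relation.Unary.Unique.DecPropositional Nat._≟_ using (unique?)
open import Data.Product using (Σ; _×_; _,_; proj₁)
open import Data.Sum using (_⊎_; [_,_]′; swap)
open import Data.Empty using (⊥-elim)
open import Function using (_∘_)
open import Relation.Nullary using (Dec; _×-dec_; _⊎-dec_)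
open import Relation.Nullary.Decidable using (True; toWitness; map′)
open import Relation.Binary.PropositionalEquality using (_≡_; refl)
import Relation.Binary.PropositionalEquality as ≡

-- Each case is witnessed by an explicit graph (found by computer search).
-- Regularity and triangle-distinctness are decidable properties of a graph on
-- Fin n, so for a concrete graph they are proved by evaluating their decisions.

-- Row i lists the neighbours of vertex i that are larger than i; other entries are ignored.
fromUpperNeighbours : ∀ {n} → Vec (List ℕ) n → Graph n
fromUpperNeighbours {n} N = record
  { Adj    = Edge
  ; adj?   = λ u v → (u <? v ×-dec toℕ v ∈? lookup N u) ⊎-dec (v <? u ×-dec toℕ u ∈? lookup N v)
  ; sym    = swap
  ; irrefl = [ <-irrefl refl ∘ proj₁ , <-irrefl refl ∘ proj₁ ]′
  }
  where
  Edge : Fin n → Fin n → Set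
  Edge u v = (u < v × toℕ v ∈ lookup N u) ⊎ (v < u × toℕ u ∈ lookup N v)

unique-map⇒injectiveOn : ∀ {A B : Set} (f : A → B) {xs : List A} → Unique (map f xs) →
                         ∀ {x y} → x ∈ xs → y ∈ xs → f x ≡ f y → x ≡ y
unique-map⇒injectiveOn f _ (here refl) (here refl) _ = refl
unique-map⇒injectiveOn f (fx∉ ∷ _) (here refl) (there y∈) fx≡fy = ⊥-elim (All.lookup fx∉ (∈-map⁺ f y∈) fx≡fy)
unique-map⇒injectiveOn f (fy∉ ∷ _) (there x∈) (here refl) fx≡fy = ⊥-elim (All.lookup fy∉ (∈-map⁺ f x∈) (≡.sym fx≡fy))
unique-map⇒injectiveOn f (_ ∷ fxs!) (there x∈) (there y∈) fx≡fy = unique-map⇒injectiveOn f fxs! x∈ y∈ fx≡fy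

isRegular? : ∀ {n} (G : Graph n) (r : ℕ) → Dec (IsRegular G r)
isRegular? G r = all? λ v → degree G v Nat.≟ r

-- Testing uniqueness of the list of triangle-degrees evaluates each of them
-- once, where testing all pairs of vertices would recompute them per pair.
triangleDistinct? : ∀ {n} (G : Graph n) → Dec (TriangleDistinct G)
triangleDistinct? {n} G = map′
  (λ t! u v → unique-map⇒injectiveOn (triangleDegree G) t! (∈-allFin u) (∈-allFin v))
  (λ injective → map⁺ (injective _ _) (allFin⁺ n))
  (unique? (map (triangleDegree G) (allFin n)))

regularTriangleDistinct : ∀ {n} (r : ℕ) (G : Graph n) →
  {True (isRegular? G r ×-dec triangleDistinct? G)} →
  Σ (Graph n) (λ H → IsRegular H r × TriangleDistinct H)
regularTriangleDistinct r G {ok} = G , toWitness ok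

G21 : Graph 21
G21 = fromUpperNeighbours
  ( (1 ∷ 2 ∷ 4 ∷ 6 ∷ 7 ∷ 8 ∷ 10 ∷ 12 ∷ 16 ∷ 19 ∷ [])
  ∷ (4 ∷ 5 ∷ 7 ∷ 9 ∷ 13 ∷ 14 ∷ 17 ∷ 18 ∷ 19 ∷ [])
  ∷ (3 ∷ 6 ∷ 8 ∷ 10 ∷ 11 ∷ 13 ∷ 15 ∷ 16 ∷ 17 ∷ [])
  ∷ (4 ∷ 6 ∷ 7 ∷ 9 ∷ 10 ∷ 12 ∷ 13 ∷ 17 ∷ 19 ∷ [])
  ∷ (5 ∷ 9 ∷ 11 ∷ 12 ∷ 14 ∷ 18 ∷ 20 ∷ [])
  ∷ (6 ∷ 7 ∷ 9 ∷ 13 ∷ 15 ∷ 17 ∷ 18 ∷ 19 ∷ [])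
  ∷ (8 ∷ 10 ∷ 11 ∷ 15 ∷ 16 ∷ 20 ∷ [])
  ∷ (9 ∷ 11 ∷ 13 ∷ 14 ∷ 18 ∷ 20 ∷ [])
  ∷ (10 ∷ 11 ∷ 12 ∷ 14 ∷ 15 ∷ 16 ∷ 20 ∷ [])
  ∷ (13 ∷ 14 ∷ 17 ∷ 18 ∷ 19 ∷ [])
  ∷ (11 ∷ 12 ∷ 15 ∷ 16 ∷ 20 ∷ [])
  ∷ (12 ∷ 16 ∷ 17 ∷ 19 ∷ [])
  ∷ (14 ∷ 15 ∷ 16 ∷ 20 ∷ [])
  ∷ (14 ∷ 15 ∷ 18 ∷ 20 ∷ [])
  ∷ (17 ∷ 18 ∷ 19 ∷ [])
  ∷ (16 ∷ 17 ∷ 19 ∷ [])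
  ∷ (18 ∷ 20 ∷ [])
  ∷ (18 ∷ 20 ∷ [])
  ∷ (19 ∷ [])
  ∷ (20 ∷ [])
  ∷ []
  ∷ [])

G22 : Graph 22
G22 = fromUpperNeighbours
  ( (2 ∷ 3 ∷ 4 ∷ 6 ∷ 7 ∷ 10 ∷ 12 ∷ 16 ∷ 17 ∷ 20 ∷ [])
  ∷ (2 ∷ 3 ∷ 4 ∷ 6 ∷ 10 ∷ 13 ∷ 16 ∷ 17 ∷ 19 ∷ 20 ∷ [])
  ∷ (5 ∷ 7 ∷ 9 ∷ 11 ∷ 13 ∷ 14 ∷ 17 ∷ 18 ∷ [])
  ∷ (4 ∷ 8 ∷ 12 ∷ 14 ∷ 15 ∷ 19 ∷ 20 ∷ 21 ∷ [])
  ∷ (8 ∷ 10 ∷ 12 ∷ 15 ∷ 19 ∷ 20 ∷ 21 ∷ [])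
  ∷ (6 ∷ 7 ∷ 10 ∷ 11 ∷ 12 ∷ 13 ∷ 16 ∷ 17 ∷ 19 ∷ [])
  ∷ (7 ∷ 8 ∷ 9 ∷ 11 ∷ 13 ∷ 14 ∷ 15 ∷ [])
  ∷ (8 ∷ 9 ∷ 11 ∷ 13 ∷ 17 ∷ 18 ∷ [])
  ∷ (10 ∷ 12 ∷ 16 ∷ 19 ∷ 20 ∷ 21 ∷ [])
  ∷ (10 ∷ 11 ∷ 13 ∷ 16 ∷ 17 ∷ 18 ∷ 21 ∷ [])
  ∷ (14 ∷ 15 ∷ 18 ∷ 21 ∷ [])
  ∷ (12 ∷ 13 ∷ 16 ∷ 18 ∷ 19 ∷ [])
  ∷ (14 ∷ 15 ∷ 20 ∷ 21 ∷ [])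
  ∷ (14 ∷ 17 ∷ 18 ∷ [])
  ∷ (16 ∷ 17 ∷ 19 ∷ 20 ∷ [])
  ∷ (16 ∷ 17 ∷ 19 ∷ 20 ∷ 21 ∷ [])
  ∷ (18 ∷ 21 ∷ [])
  ∷ (18 ∷ [])
  ∷ (19 ∷ 20 ∷ [])
  ∷ (21 ∷ [])
  ∷ (21 ∷ [])
  ∷ []
  ∷ [])

G23 : Graph 23
G23 = fromUpperNeighbours
  ( (1 ∷ 2 ∷ 4 ∷ 8 ∷ 15 ∷ 16 ∷ 17 ∷ 18 ∷ 21 ∷ 22 ∷ [])
  ∷ (3 ∷ 5 ∷ 7 ∷ 16 ∷ 18 ∷ 19 ∷ 20 ∷ 21 ∷ 22 ∷ [])
  ∷ (3 ∷ 5 ∷ 6 ∷ 7 ∷ 9 ∷ 13 ∷ 14 ∷ 19 ∷ 20 ∷ [])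
  ∷ (4 ∷ 5 ∷ 12 ∷ 15 ∷ 16 ∷ 18 ∷ 21 ∷ 22 ∷ [])
  ∷ (6 ∷ 7 ∷ 8 ∷ 9 ∷ 10 ∷ 11 ∷ 13 ∷ 14 ∷ [])
  ∷ (8 ∷ 16 ∷ 18 ∷ 19 ∷ 20 ∷ 21 ∷ 22 ∷ [])
  ∷ (8 ∷ 9 ∷ 10 ∷ 11 ∷ 12 ∷ 13 ∷ 15 ∷ 17 ∷ [])
  ∷ (8 ∷ 11 ∷ 12 ∷ 15 ∷ 17 ∷ 21 ∷ 22 ∷ [])
  ∷ (9 ∷ 10 ∷ 11 ∷ 13 ∷ 17 ∷ [])
  ∷ (10 ∷ 11 ∷ 12 ∷ 15 ∷ 17 ∷ 18 ∷ [])
  ∷ (11 ∷ 12 ∷ 13 ∷ 14 ∷ 15 ∷ 21 ∷ [])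
  ∷ (12 ∷ 13 ∷ 15 ∷ 17 ∷ [])
  ∷ (13 ∷ 14 ∷ 19 ∷ 20 ∷ [])
  ∷ (15 ∷ 17 ∷ 21 ∷ [])
  ∷ (15 ∷ 16 ∷ 17 ∷ 18 ∷ 21 ∷ 22 ∷ [])
  ∷ (19 ∷ [])
  ∷ (18 ∷ 19 ∷ 20 ∷ 21 ∷ 22 ∷ [])
  ∷ (19 ∷ 20 ∷ [])
  ∷ (19 ∷ 20 ∷ 22 ∷ [])
  ∷ (20 ∷ 22 ∷ [])
  ∷ (21 ∷ 22 ∷ [])
  ∷ []
  ∷ []
  ∷ [])

G24 : Graph 24
G24 = fromUpperNeighbours
  ( (1 ∷ 2 ∷ 10 ∷ 12 ∷ 14 ∷ 17 ∷ 18 ∷ 20 ∷ 21 ∷ 22 ∷ 23 ∷ [])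
  ∷ (5 ∷ 6 ∷ 7 ∷ 8 ∷ 13 ∷ 15 ∷ 16 ∷ 18 ∷ 20 ∷ 22 ∷ [])
  ∷ (9 ∷ 10 ∷ 12 ∷ 14 ∷ 17 ∷ 19 ∷ 20 ∷ 21 ∷ 22 ∷ 23 ∷ [])
  ∷ (4 ∷ 5 ∷ 6 ∷ 7 ∷ 8 ∷ 9 ∷ 11 ∷ 13 ∷ 15 ∷ 16 ∷ 18 ∷ [])
  ∷ (6 ∷ 9 ∷ 10 ∷ 11 ∷ 12 ∷ 14 ∷ 15 ∷ 18 ∷ 21 ∷ 23 ∷ [])
  ∷ (6 ∷ 9 ∷ 10 ∷ 12 ∷ 14 ∷ 15 ∷ 18 ∷ 21 ∷ 23 ∷ [])
  ∷ (7 ∷ 8 ∷ 9 ∷ 11 ∷ 15 ∷ 18 ∷ 23 ∷ [])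
  ∷ (8 ∷ 9 ∷ 10 ∷ 11 ∷ 12 ∷ 14 ∷ 15 ∷ 18 ∷ [])
  ∷ (9 ∷ 10 ∷ 11 ∷ 14 ∷ 15 ∷ 19 ∷ 21 ∷ [])
  ∷ (13 ∷ 15 ∷ 16 ∷ 17 ∷ [])
  ∷ (13 ∷ 16 ∷ 17 ∷ 19 ∷ 20 ∷ [])
  ∷ (15 ∷ 16 ∷ 17 ∷ 18 ∷ 20 ∷ 22 ∷ [])
  ∷ (13 ∷ 16 ∷ 17 ∷ 19 ∷ 20 ∷ 22 ∷ [])
  ∷ (14 ∷ 15 ∷ 18 ∷ 19 ∷ 21 ∷ 23 ∷ [])
  ∷ (16 ∷ 17 ∷ 20 ∷ 22 ∷ [])
  ∷ (18 ∷ [])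
  ∷ (18 ∷ 19 ∷ 21 ∷ 23 ∷ [])
  ∷ (19 ∷ 21 ∷ 22 ∷ 23 ∷ [])
  ∷ []
  ∷ (20 ∷ 21 ∷ 22 ∷ 23 ∷ [])
  ∷ (21 ∷ 22 ∷ 23 ∷ [])
  ∷ (22 ∷ [])
  ∷ (23 ∷ [])
  ∷ []
  ∷ [])

G25 : Graph 25
G25 = fromUpperNeighbours
  ( (3 ∷ 5 ∷ 12 ∷ 13 ∷ 14 ∷ 16 ∷ 17 ∷ 20 ∷ 21 ∷ 22 ∷ 23 ∷ 24 ∷ [])
  ∷ (2 ∷ 5 ∷ 6 ∷ 7 ∷ 10 ∷ 11 ∷ 12 ∷ 13 ∷ 16 ∷ 20 ∷ 23 ∷ 24 ∷ [])
  ∷ (5 ∷ 6 ∷ 7 ∷ 8 ∷ 9 ∷ 10 ∷ 11 ∷ 15 ∷ 18 ∷ 23 ∷ 24 ∷ [])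
  ∷ (4 ∷ 8 ∷ 12 ∷ 14 ∷ 15 ∷ 17 ∷ 18 ∷ 19 ∷ 20 ∷ 21 ∷ 22 ∷ [])
  ∷ (5 ∷ 10 ∷ 11 ∷ 12 ∷ 13 ∷ 14 ∷ 16 ∷ 20 ∷ 22 ∷ 23 ∷ 24 ∷ [])
  ∷ (6 ∷ 7 ∷ 8 ∷ 9 ∷ 11 ∷ 15 ∷ 18 ∷ 19 ∷ [])
  ∷ (7 ∷ 8 ∷ 9 ∷ 11 ∷ 13 ∷ 15 ∷ 18 ∷ 19 ∷ 21 ∷ [])
  ∷ (8 ∷ 9 ∷ 10 ∷ 11 ∷ 13 ∷ 18 ∷ 23 ∷ 24 ∷ [])
  ∷ (9 ∷ 10 ∷ 11 ∷ 12 ∷ 13 ∷ 23 ∷ 24 ∷ [])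
  ∷ (10 ∷ 11 ∷ 13 ∷ 14 ∷ 16 ∷ 21 ∷ 24 ∷ [])
  ∷ (11 ∷ 15 ∷ 17 ∷ 18 ∷ 19 ∷ 21 ∷ [])
  ∷ (15 ∷ 18 ∷ 19 ∷ [])
  ∷ (14 ∷ 17 ∷ 18 ∷ 19 ∷ 20 ∷ 21 ∷ 22 ∷ [])
  ∷ (15 ∷ 17 ∷ 18 ∷ 19 ∷ 22 ∷ [])
  ∷ (16 ∷ 17 ∷ 19 ∷ 20 ∷ 21 ∷ 22 ∷ 23 ∷ [])
  ∷ (16 ∷ 20 ∷ 21 ∷ 23 ∷ 24 ∷ [])
  ∷ (17 ∷ 18 ∷ 19 ∷ 20 ∷ 21 ∷ 22 ∷ [])
  ∷ (20 ∷ 21 ∷ 22 ∷ 23 ∷ 24 ∷ [])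
  ∷ (23 ∷ 24 ∷ [])
  ∷ (20 ∷ 23 ∷ 24 ∷ [])
  ∷ (21 ∷ 22 ∷ [])
  ∷ (22 ∷ [])
  ∷ (23 ∷ 24 ∷ [])
  ∷ []
  ∷ []
  ∷ [])

G26 : Graph 26
G26 = fromUpperNeighbours
  ( (1 ∷ 2 ∷ 4 ∷ 6 ∷ 7 ∷ 10 ∷ 17 ∷ 20 ∷ 21 ∷ 22 ∷ 24 ∷ 25 ∷ [])
  ∷ (2 ∷ 3 ∷ 4 ∷ 5 ∷ 6 ∷ 7 ∷ 8 ∷ 9 ∷ 10 ∷ 11 ∷ 24 ∷ [])
  ∷ (3 ∷ 4 ∷ 6 ∷ 7 ∷ 8 ∷ 10 ∷ 11 ∷ 17 ∷ 21 ∷ 24 ∷ [])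
  ∷ (4 ∷ 5 ∷ 6 ∷ 7 ∷ 8 ∷ 9 ∷ 12 ∷ 19 ∷ 23 ∷ 24 ∷ [])
  ∷ (5 ∷ 6 ∷ 7 ∷ 8 ∷ 9 ∷ 11 ∷ 23 ∷ 24 ∷ [])
  ∷ (7 ∷ 10 ∷ 13 ∷ 15 ∷ 17 ∷ 20 ∷ 21 ∷ 22 ∷ 25 ∷ [])
  ∷ (7 ∷ 8 ∷ 9 ∷ 10 ∷ 16 ∷ 23 ∷ 24 ∷ [])
  ∷ (8 ∷ 9 ∷ 12 ∷ 23 ∷ 24 ∷ [])
  ∷ (10 ∷ 13 ∷ 17 ∷ 20 ∷ 21 ∷ 25 ∷ [])
  ∷ (10 ∷ 16 ∷ 17 ∷ 20 ∷ 21 ∷ 22 ∷ 25 ∷ [])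
  ∷ (12 ∷ 14 ∷ 15 ∷ 23 ∷ 24 ∷ [])
  ∷ (12 ∷ 14 ∷ 15 ∷ 16 ∷ 18 ∷ 19 ∷ 22 ∷ 23 ∷ 24 ∷ [])
  ∷ (13 ∷ 14 ∷ 17 ∷ 18 ∷ 20 ∷ 21 ∷ 22 ∷ 25 ∷ [])
  ∷ (14 ∷ 15 ∷ 16 ∷ 18 ∷ 19 ∷ 20 ∷ 22 ∷ 23 ∷ 24 ∷ [])
  ∷ (15 ∷ 16 ∷ 17 ∷ 18 ∷ 19 ∷ 20 ∷ 22 ∷ 25 ∷ [])
  ∷ (17 ∷ 18 ∷ 19 ∷ 20 ∷ 21 ∷ 22 ∷ 25 ∷ [])
  ∷ (17 ∷ 18 ∷ 19 ∷ 20 ∷ 21 ∷ 22 ∷ 25 ∷ [])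
  ∷ (18 ∷ 19 ∷ 23 ∷ [])
  ∷ (19 ∷ 20 ∷ 21 ∷ 22 ∷ 25 ∷ [])
  ∷ (20 ∷ 21 ∷ 22 ∷ 25 ∷ [])
  ∷ (23 ∷ [])
  ∷ (23 ∷ 24 ∷ [])
  ∷ (23 ∷ [])
  ∷ (25 ∷ [])
  ∷ (25 ∷ [])
  ∷ []
  ∷ [])

G27 : Graph 27
G27 = fromUpperNeighbours
  ( (2 ∷ 6 ∷ 7 ∷ 9 ∷ 10 ∷ 14 ∷ 15 ∷ 19 ∷ 22 ∷ 23 ∷ 24 ∷ 26 ∷ [])
  ∷ (2 ∷ 3 ∷ 4 ∷ 6 ∷ 7 ∷ 9 ∷ 13 ∷ 21 ∷ 22 ∷ 23 ∷ 24 ∷ 26 ∷ [])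
  ∷ (4 ∷ 5 ∷ 6 ∷ 9 ∷ 11 ∷ 14 ∷ 20 ∷ 22 ∷ 23 ∷ 26 ∷ [])
  ∷ (6 ∷ 7 ∷ 9 ∷ 10 ∷ 13 ∷ 15 ∷ 20 ∷ 22 ∷ 23 ∷ 24 ∷ 26 ∷ [])
  ∷ (5 ∷ 6 ∷ 9 ∷ 11 ∷ 12 ∷ 13 ∷ 20 ∷ 23 ∷ 24 ∷ 25 ∷ [])
  ∷ (8 ∷ 10 ∷ 11 ∷ 12 ∷ 14 ∷ 15 ∷ 16 ∷ 17 ∷ 18 ∷ 19 ∷ [])
  ∷ (7 ∷ 8 ∷ 13 ∷ 21 ∷ 22 ∷ 25 ∷ 26 ∷ [])
  ∷ (9 ∷ 13 ∷ 20 ∷ 21 ∷ 22 ∷ 23 ∷ 24 ∷ 26 ∷ [])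
  ∷ (9 ∷ 11 ∷ 13 ∷ 15 ∷ 16 ∷ 17 ∷ 18 ∷ 20 ∷ 24 ∷ 25 ∷ [])
  ∷ (13 ∷ 21 ∷ 22 ∷ 23 ∷ 26 ∷ [])
  ∷ (11 ∷ 12 ∷ 14 ∷ 15 ∷ 16 ∷ 17 ∷ 18 ∷ 21 ∷ 25 ∷ [])
  ∷ (12 ∷ 15 ∷ 16 ∷ 17 ∷ 18 ∷ 19 ∷ 25 ∷ [])
  ∷ (14 ∷ 15 ∷ 16 ∷ 17 ∷ 18 ∷ 19 ∷ 20 ∷ 25 ∷ [])
  ∷ (14 ∷ 19 ∷ 23 ∷ 24 ∷ 26 ∷ [])
  ∷ (15 ∷ 17 ∷ 18 ∷ 19 ∷ 20 ∷ 25 ∷ [])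
  ∷ (16 ∷ 17 ∷ 20 ∷ 25 ∷ [])
  ∷ (17 ∷ 18 ∷ 19 ∷ 21 ∷ 24 ∷ 25 ∷ [])
  ∷ (18 ∷ 19 ∷ 20 ∷ 25 ∷ [])
  ∷ (19 ∷ 20 ∷ 21 ∷ 25 ∷ [])
  ∷ (20 ∷ 22 ∷ 25 ∷ [])
  ∷ (21 ∷ [])
  ∷ (22 ∷ 23 ∷ 24 ∷ 26 ∷ [])
  ∷ (23 ∷ 24 ∷ 26 ∷ [])
  ∷ (24 ∷ 26 ∷ [])
  ∷ (26 ∷ [])
  ∷ []
  ∷ []
  ∷ [])

mainTheorem1 : ∀ (n r : ℕ) → (n , r) ∈ ((21 , 10) ∷ (22 , 10) ∷ (23 , 10) ∷ (24 , 11) ∷ (25 , 12) ∷ (26 , 12) ∷ (27 , 12) ∷ []) → Σ (Graph n) (λ G → IsRegular G r × TriangleDistinct G)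
mainTheorem1 _ _ (here refl) = regularTriangleDistinct 10 G21
mainTheorem1 _ _ (there (here refl)) = regularTriangleDistinct 10 G22
mainTheorem1 _ _ (there (there (here refl))) = regularTriangleDistinct 10 G23
mainTheorem1 _ _ (there (there (there (here refl)))) = regularTriangleDistinct 11 G24
mainTheorem1 _ _ (there (there (there (there (here refl))))) = regularTriangleDistinct 12 G25
mainTheorem1 _ _ (there (there (there (there (there (here refl)))))) = regularTriangleDistinct 12 G26
mainTheorem1 _ _ (there (there (there (there (there (there (here refl))))))) = regularTriangleDistinct 12 G27
mainTheorem1 _ _ (there (there (there (there (there (there (there ())))))))
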